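{- Let $s> 3$ be an integer and let $A \subseteq \{0,1,\ldots,s-1\}$ with $|A| \geq 2s/3 +1$. Then there exist two elements $a_i,a_j\in A$ with $a_j-a_i=1$ such that, for $G=\{a_i,a_j\}$, one has $G^{good}=A$ (relative to $A$).
   Context: For $G\subseteq A\subseteq \{0,\ldots,s-1\}$, define $G^{(0)}=G$ and, for $i\ge 0$, $G^{(i+1)}$ to be the set of elements $e\in A$ that can be written as $e=b+c-a$ with $a,b,c\in G^{(i)}$ (not necessarily distinct). Then $G^{good}=\bigcup_{i\geq 0} G^{(i)}$. -}

module Defs where

open import Data.Nat using (ℕ; zero; suc; _+_)
open import Data.Fin using (Fin; toℕ)
open import Data.Fin.Subset using (Subset; _∈_)
open import Data.Product using (∃; _×_)
open import Relation.Binary.PropositionalEquality using (_≡_)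

-- Subsets of {0,…,s-1} are represented as Subset s; element e : Fin s
-- stands for the integer toℕ e.

-- G^(i) relative to A: level i of the iteration.
-- G^(0) = G;  G^(i+1) = { e ∈ A | e = b + c - a, a,b,c ∈ G^(i) }
-- (e = b + c - a written as e + a = b + c over ℕ).
data Level {s : ℕ} (A G : Subset s) : ℕ → Fin s → Set where
  base : ∀ {e} → e ∈ G → Level A G zero e
  step : ∀ {i e} (a b c : Fin s) →
         Level A G i a → Level A G i b → Level A G i c →
         e ∈ A → toℕ e + toℕ a ≡ toℕ b + toℕ c →
         Level A G (suc i) e

InGood : ∀ {s} → Subset s → Subset s → Fin s → Set
InGood A G e = ∃ λ i → Level A G i e

GoodEq : ∀ {s} → Subset s → Subset s → Set
GoodEq {s} A G = (e : Fin s) → (InGood A G e → e ∈ A) × (e ∈ A → InGood A G e)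

module Submission where

-- Let A ⊆ {0,…,s-1} with 3|A| ≥ 2s + 3.  Read A as a ±1 walk:
-- F n = #(A ∩ [0,n)) − #([0,n) ∖ A); the hypothesis says 3 F(s) ≥ s + 6.
--
-- 1. Pairing: if the walk rises strictly across a window [lo,hi), one of the
--    symmetric pairs (lo+k, hi−1−k) lies in A, i.e. c, c' ∈ A ∩ [lo,hi) with
--    c + c' + 1 = lo + hi.  Since G^good is closed under e = c + c' − u, an
--    element e ∈ A with e + u + 1 = lo + hi is good as soon as u and all of
--    A ∩ [lo,hi) are good ("filling").
-- 2. Pivot: there is x with x, x+1 ∈ A, F ≥ F(x) + 2 on [x+2, s] and
--    F ≤ F(s) − 2 on [0, x].  It is found from the first time ρ the walk reaches
--    F(s) − 1, the minimum of F on [ρ, s], and a descent along the walk below ρ;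
--    the inequality 3 F(s) ≥ s + 6 is exactly what the descent needs.
-- 3. With G = {x, x+1}, filling with u = x and windows [x+1, e) makes every
--    e ∈ A with e ≥ x good; then filling with u = the last up-step of the walk
--    and windows [e+1, u) makes every e ∈ A below x good, downwards.

open import Defs
open import Data.Nat using (ℕ; _+_; _*_; _<_; _≤_; suc)
open import Data.Fin using (Fin; toℕ)
open import Data.Fin.Subset using (Subset; _∈_; ∣_∣; ⁅_⁆; _∪_)
open import Data.Product using (∃₂; _×_)
open import Relation.Binary.PropositionalEquality using (_≡_)

open import Data.Nat using (zero; z≤n; s≤s; _∸_)
import Data.Nat.Properties as ℕP
open import Data.Fin using (zero; suc)
import Data.Fin.Properties as FinP
open import Data.Fin.Subset.Properties using (x∈p∪q⁻; x∈p∪q⁺; x∈⁅x⁆; x∈⁅y⁆⇒x≡y)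
open import Data.Vec using (Vec; []; _∷_; here; there)
open import Data.Bool using (Bool; true; false)
open import Data.Integer using (ℤ; +_; 0ℤ; 1ℤ; -1ℤ; +≤+)
  renaming (_+_ to _+ᶻ_; _*_ to _*ᶻ_; _≤_ to _≤ᶻ_; _<_ to _<ᶻ_; -_ to -ᶻ_)
import Data.Integer.Properties as ℤP
open import Data.Integer.Tactic.RingSolver using (solve-∀)
open import Data.Product using (Σ; _,_)
open import Data.Sum using (_⊎_; inj₁; inj₂; [_,_]′)
open import Data.Empty using (⊥-elim)
open import Relation.Binary.PropositionalEquality
  using (refl; sym; trans; cong; subst; subst₂; module ≡-Reasoning)
open import Relation.Nullary using (Dec; yes; no; ¬_)

-- Linear arithmetic over ℤ is done by certificates: a ≤ b follows from x ≤ y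
-- (a sum of known inequalities, built with _⊕_) once the ring solver checks the
-- identity a + y = b + x.
≤-by : ∀ {a b x y : ℤ} → x ≤ᶻ y → a +ᶻ y ≡ b +ᶻ x → a ≤ᶻ b
≤-by {a} {b} {x} x≤y eq =
  subst₂ _≤ᶻ_ (cancel a x) (cancel b x)
    (ℤP.+-monoˡ-≤ (-ᶻ x) (ℤP.≤-trans (ℤP.+-monoʳ-≤ a x≤y) (ℤP.≤-reflexive eq)))
  where
  cancel : ∀ u v → (u +ᶻ v) +ᶻ (-ᶻ v) ≡ u
  cancel = solve-∀

_⊕_ : ∀ {x y u v : ℤ} → x ≤ᶻ y → u ≤ᶻ v → x +ᶻ u ≤ᶻ y +ᶻ v
_⊕_ = ℤP.+-mono-≤
infixl 6 _⊕_

slack : ∀ n → 0ℤ ≤ᶻ + n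
slack n = +≤+ z≤n

two-below : ∀ {u v θ : ℤ} → u ≤ᶻ θ → θ +ᶻ + 2 ≤ᶻ v → u +ᶻ + 2 ≤ᶻ v
two-below {u} {v} {θ} u≤θ θ+2≤v = ≤-by (u≤θ ⊕ θ+2≤v) (arith u v θ)
  where
  arith : ∀ u v θ → (u +ᶻ + 2) +ᶻ (θ +ᶻ v) ≡ v +ᶻ (u +ᶻ (θ +ᶻ + 2))
  arith = solve-∀

pos≰0 : ∀ {n} → ¬ (+ suc n ≤ᶻ 0ℤ)
pos≰0 (+≤+ ())

≤-suc-cases : ∀ {e n} → e ≤ suc n → e ≤ n ⊎ e ≡ suc n
≤-suc-cases e≤sn with ℕP.m≤n⇒m<n∨m≡n e≤sn
... | inj₁ e<sn = inj₁ (ℕP.≤-pred e<sn)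
... | inj₂ e≡sn = inj₂ e≡sn

extend-≤ : ∀ {P : ℕ → Set} {n} → (∀ {e} → e ≤ n → P e) → P (suc n) →
           ∀ {e} → e ≤ suc n → P e
extend-≤ below top e≤sn with ≤-suc-cases e≤sn
... | inj₁ e≤n  = below e≤n
... | inj₂ refl = top

monotone : (f : ℕ → ℤ) → (∀ n → f n ≤ᶻ f (suc n)) → ∀ {i j} → i ≤ j → f i ≤ᶻ f j
monotone f steps {j = zero} z≤n = ℤP.≤-refl
monotone f steps {j = suc j} i≤sj with ≤-suc-cases i≤sj
... | inj₁ i≤j  = ℤP.≤-trans (monotone f steps i≤j) (steps j)
... | inj₂ refl = ℤP.≤-refl

record LeastWitness (P : ℕ → Set) (n : ℕ) : Set where
  constructor least
  field
    ρ     : ℕ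
    ρ≤n   : ρ ≤ n
    holds : P ρ
    first : ∀ {e} → e < ρ → ¬ P e

module _ {P : ℕ → Set} (P? : ∀ n → Dec (P n)) where

  search : ∀ m → (∀ {e} → e < m → ¬ P e) ⊎ LeastWitness P m
  search zero = inj₁ λ ()
  search (suc m) with search m
  ... | inj₂ (least ρ ρ≤m Pρ first) = inj₂ (least ρ (ℕP.m≤n⇒m≤1+n ρ≤m) Pρ first)
  ... | inj₁ none with P? m
  ...   | yes Pm = inj₂ (least m (ℕP.n≤1+n m) Pm none)
  ...   | no ¬Pm = inj₁ below
    where
    below : ∀ {e} → e < suc m → ¬ P e
    below e<sm with ℕP.m<1+n⇒m<n∨m≡n e<sm
    ... | inj₁ e<m  = none e<m
    ... | inj₂ refl = ¬Pm

  least-witness : ∀ {n} → P n → LeastWitness P n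
  least-witness {n} Pn with search n
  ... | inj₁ none = least n ℕP.≤-refl Pn none
  ... | inj₂ w    = w

record Minimum (f : ℕ → ℤ) (lo hi : ℕ) : Set where
  constructor minimum
  field
    j       : ℕ
    lo≤j    : lo ≤ j
    j≤hi    : j ≤ hi
    minimal : ∀ {e} → e ≤ hi → lo ≤ e → f j ≤ᶻ f e

minimum-on : (f : ℕ → ℤ) → ∀ {lo} hi → lo ≤ hi → Minimum f lo hi
minimum-on f {lo} hi lo≤hi with ℕP.m≤n⇒m<n∨m≡n lo≤hi
minimum-on f {lo} .lo _ | inj₂ refl = minimum lo ℕP.≤-refl ℕP.≤-refl point
  where
  point : ∀ {e} → e ≤ lo → lo ≤ e → f lo ≤ᶻ f e
  point e≤lo lo≤e with ℕP.≤-antisym lo≤e e≤lo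
  ... | refl = ℤP.≤-refl
minimum-on f {lo} (suc hi) _ | inj₁ lo<shi
  with minimum-on f hi (ℕP.≤-pred lo<shi)
... | minimum j lo≤j j≤hi minimal with ℤP.≤-total (f j) (f (suc hi))
...   | inj₁ fj≤ = minimum j lo≤j (ℕP.m≤n⇒m≤1+n j≤hi) (extend-≤ minimal (λ _ → fj≤))
...   | inj₂ ≤fj = minimum (suc hi) (ℕP.<⇒≤ lo<shi) ℕP.≤-refl
                     (extend-≤ (λ e≤hi lo≤e → ℤP.≤-trans ≤fj (minimal e≤hi lo≤e)) (λ _ → ℤP.≤-refl))

move : Bool → ℤ
move true  = 1ℤ
move false = -1ℤ

module Walk (a : ℕ → Bool) where

  F : ℕ → ℤ
  F zero    = 0ℤ
  F (suc n) = F n +ᶻ move (a n)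

  data StepAt (n : ℕ) : Set where
    up   : a n ≡ true  → F (suc n) ≡ F n +ᶻ 1ℤ  → StepAt n
    down : a n ≡ false → F (suc n) ≡ F n +ᶻ -1ℤ → StepAt n

  up-step : ∀ {n} → a n ≡ true → F (suc n) ≡ F n +ᶻ 1ℤ
  up-step {n} a≡ = cong (λ b → F n +ᶻ move b) a≡

  step-at : ∀ n → StepAt n
  step-at n with a n in a≡
  ... | true  = up a≡ (up-step a≡)
  ... | false = down a≡ (cong (λ b → F n +ᶻ move b) a≡)

  rising-step : ∀ {n} → F n <ᶻ F (suc n) → a n ≡ true
  rising-step {n} rise with step-at n
  ... | up a≡ _     = a≡
  ... | down _ F≡   = ⊥-elim (pos≰0 {1} (≤-by (ℤP.i<j⇒suc[i]≤j rise ⊕ ℤP.≤-reflexive F≡)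
                                             (arith (F n) (F (suc n)))))
    where
    arith : ∀ u v → + 2 +ᶻ (v +ᶻ (u +ᶻ -1ℤ)) ≡ 0ℤ +ᶻ ((1ℤ +ᶻ u) +ᶻ v)
    arith = solve-∀

  down-≤ : ∀ {n} → F (suc n) ≡ F n +ᶻ -1ℤ → F (suc n) ≤ᶻ F n
  down-≤ {n} F≡ = ≤-by (ℤP.≤-reflexive F≡ ⊕ slack 1) (arith (F n) (F (suc n)))
    where
    arith : ∀ v w → w +ᶻ ((v +ᶻ -1ℤ) +ᶻ + 1) ≡ v +ᶻ (w +ᶻ 0ℤ)
    arith = solve-∀

  step-≤ : ∀ n → F (suc n) ≤ᶻ F n +ᶻ 1ℤ
  step-≤ n with step-at n
  ... | up _ F≡   = ℤP.≤-reflexive F≡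
  ... | down _ F≡ = ℤP.≤-trans (down-≤ {n} F≡) (ℤP.i≤i+j (F n) 1ℤ)

  -- F n + n, twice the number of elements below n, never decreases.
  F+n-mono : ∀ {i j} → i ≤ j → F i +ᶻ + i ≤ᶻ F j +ᶻ + j
  F+n-mono = monotone (λ n → F n +ᶻ + n) rise
    where
    rise : ∀ n → F n +ᶻ + n ≤ᶻ F (suc n) +ᶻ + suc n
    rise n with step-at n
    ... | up _ F≡   = ≤-by (ℤP.≤-reflexive (sym F≡) ⊕ slack 2)
                        (arith (F n) (F (suc n)) (+ n))
      where
      arith : ∀ u v N → (u +ᶻ N) +ᶻ (v +ᶻ + 2) ≡ (v +ᶻ (1ℤ +ᶻ N)) +ᶻ ((u +ᶻ 1ℤ) +ᶻ 0ℤ)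
      arith = solve-∀
    ... | down _ F≡ = ≤-by (ℤP.≤-reflexive (sym F≡)) (arith (F n) (F (suc n)) (+ n))
      where
      arith : ∀ u v N → (u +ᶻ N) +ᶻ v ≡ (v +ᶻ (1ℤ +ᶻ N)) +ᶻ (u +ᶻ -1ℤ)
      arith = solve-∀

  -- F n − n, minus twice the number of non-elements below n, never increases.
  F-n-anti : ∀ {i j} → i ≤ j → F j +ᶻ + i ≤ᶻ F i +ᶻ + j
  F-n-anti {i} {j} i≤j =
    ≤-by (monotone (λ n → + n +ᶻ -ᶻ F n) fall i≤j) (arith (F i) (F j) (+ i) (+ j))
    where
    fall : ∀ n → + n +ᶻ -ᶻ F n ≤ᶻ + suc n +ᶻ -ᶻ F (suc n)
    fall n = ≤-by (step-≤ n) (arith′ (F n) (F (suc n)) (+ n))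
      where
      arith′ : ∀ u v N → (N +ᶻ -ᶻ u) +ᶻ (u +ᶻ 1ℤ) ≡ ((1ℤ +ᶻ N) +ᶻ -ᶻ v) +ᶻ v
      arith′ = solve-∀
    arith : ∀ u v I J → (v +ᶻ I) +ᶻ (J +ᶻ -ᶻ v) ≡ (u +ᶻ J) +ᶻ (I +ᶻ -ᶻ u)
    arith = solve-∀

  record SymmetricPair (lo hi : ℕ) : Set where
    constructor sym-pair
    field
      c c'  : ℕ
      lo≤c  : lo ≤ c
      c<hi  : c < hi
      lo≤c' : lo ≤ c'
      c'<hi : c' < hi
      c∈A   : a c ≡ true
      c'∈A  : a c' ≡ true
      sum   : suc (c + c') ≡ lo + hi

  widen : ∀ {lo hi} → SymmetricPair (suc lo) hi → SymmetricPair lo (suc hi)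
  widen {lo} {hi} (sym-pair c c' lo<c c<hi lo<c' c'<hi c∈A c'∈A sum) =
    sym-pair c c' (ℕP.<⇒≤ lo<c) (ℕP.m≤n⇒m≤1+n c<hi) (ℕP.<⇒≤ lo<c') (ℕP.m≤n⇒m≤1+n c'<hi)
      c∈A c'∈A (trans sum (sym (ℕP.+-suc lo hi)))

  -- If the walk rises strictly across a window of length n, then
  -- some symmetric pair of positions lies in A: otherwise the two end positions
  -- together do not rise, and the inner window still rises strictly.
  pairing : ∀ n {lo hi} → n + lo ≡ hi → F lo <ᶻ F hi → SymmetricPair lo hi
  pairing zero refl rise = ⊥-elim (ℤP.<-irrefl refl rise)
  pairing (suc zero) {lo} refl rise =
    sym-pair lo lo ℕP.≤-refl ℕP.≤-refl ℕP.≤-refl ℕP.≤-refl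
      (rising-step rise) (rising-step rise) (sym (ℕP.+-suc lo lo))
  pairing (suc (suc m)) {lo} refl rise with step-at lo | step-at (suc (m + lo))
  ... | up lo∈A _ | up r∈A _ =
    sym-pair lo (suc (m + lo)) ℕP.≤-refl (s≤s (ℕP.m≤n⇒m≤1+n lo≤m+lo))
      (ℕP.m≤n⇒m≤1+n lo≤m+lo) ℕP.≤-refl lo∈A r∈A (sym (ℕP.+-suc lo (suc (m + lo))))
    where
    lo≤m+lo : lo ≤ m + lo
    lo≤m+lo = ℕP.m≤n+m lo m
  ... | down _ F≡ | _ = widen (pairing m (ℕP.+-suc m lo) (ℤP.suc[i]≤j⇒i<j
    (≤-by (ℤP.i<j⇒suc[i]≤j rise ⊕ ℤP.≤-reflexive F≡ ⊕ step-≤ (suc (m + lo)))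
      (arith (F lo) (F (suc lo)) (F (suc (m + lo))) (F (suc (suc (m + lo))))))))
    where
    arith : ∀ u v w z → (1ℤ +ᶻ v) +ᶻ ((z +ᶻ (u +ᶻ -1ℤ)) +ᶻ (w +ᶻ 1ℤ))
                        ≡ w +ᶻ (((1ℤ +ᶻ u) +ᶻ v) +ᶻ z)
    arith = solve-∀
  ... | up _ F≡ | down _ F≡′ = widen (pairing m (ℕP.+-suc m lo) (ℤP.suc[i]≤j⇒i<j
    (≤-by (ℤP.i<j⇒suc[i]≤j rise ⊕ ℤP.≤-reflexive F≡ ⊕ ℤP.≤-reflexive F≡′)
      (arith (F lo) (F (suc lo)) (F (suc (m + lo))) (F (suc (suc (m + lo))))))))
    where
    arith : ∀ u v w z → (1ℤ +ᶻ v) +ᶻ ((z +ᶻ (u +ᶻ 1ℤ)) +ᶻ (w +ᶻ -1ℤ))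
                        ≡ w +ᶻ (((1ℤ +ᶻ u) +ᶻ v) +ᶻ z)
    arith = solve-∀

  record LastUpStep (lo hi : ℕ) : Set where
    constructor last-up
    field
      u       : ℕ
      lo≤u    : lo ≤ u
      u<hi    : u < hi
      u∈A     : a u ≡ true
      reaches : F hi ≤ᶻ F (suc u)

  -- The last up-step of a window across which the walk rises reaches the final height:
  -- after it there are only down-steps.
  last-up-step : ∀ n {lo hi} → n + lo ≡ hi → F lo <ᶻ F hi → LastUpStep lo hi
  last-up-step zero refl rise = ⊥-elim (ℤP.<-irrefl refl rise)
  last-up-step (suc n) {lo} refl rise with step-at (n + lo)
  ... | up p∈A _  = last-up (n + lo) (ℕP.m≤n+m lo n) ℕP.≤-refl p∈A ℤP.≤-refl
  ... | down _ F≡ with last-up-step n refl (ℤP.<-≤-trans rise (down-≤ {n + lo} F≡))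
  ...   | last-up u lo≤u u<p u∈A reaches =
    last-up u lo≤u (ℕP.m≤n⇒m≤1+n u<p) u∈A (ℤP.≤-trans (down-≤ {n + lo} F≡) reaches)

  record Springboard (y : ℕ) : Set where
    constructor springboard
    field
      x     : ℕ
      x+2≤y : suc (suc x) ≤ y
      x∈A   : a x ≡ true
      x+1∈A : a (suc x) ≡ true
      above : ∀ {e} → e ≤ y → suc (suc x) ≤ e → F x +ᶻ + 2 ≤ᶻ F e

  record Descent (y : ℕ) (θ : ℤ) : Set where
    constructor descended
    field
      board : Springboard y
      low   : F (Springboard.x board) ≤ᶻ θ

  grow : ∀ {y θ} → Descent y θ → θ +ᶻ + 2 ≤ᶻ F (suc y) → Descent (suc y) θ
  grow (descended (springboard x x+2≤y x∈A x+1∈A above) low) high =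
    descended (springboard x (ℕP.m≤n⇒m≤1+n x+2≤y) x∈A x+1∈A
                 (extend-≤ above (λ _ → two-below low high)))
              low

  weaken : ∀ {y θ θ′} → Descent y θ → θ ≤ᶻ θ′ → Descent y θ′
  weaken (descended b low) θ≤θ′ = descended b (ℤP.≤-trans low θ≤θ′)

  two-ups : ∀ {x} → a x ≡ true → a (suc x) ≡ true → Descent (suc (suc x)) (F x)
  two-ups {x} x∈A x+1∈A = descended (springboard x ℕP.≤-refl x∈A x+1∈A above) ℤP.≤-refl
    where
    above : ∀ {e} → e ≤ suc (suc x) → suc (suc x) ≤ e → F x +ᶻ + 2 ≤ᶻ F e
    above e≤ ≤e with ℕP.≤-antisym e≤ ≤e
    ... | refl = ℤP.≤-reflexive (begin
      F x +ᶻ + 2                  ≡⟨ ℤP.+-assoc (F x) 1ℤ 1ℤ ⟨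
      (F x +ᶻ 1ℤ) +ᶻ 1ℤ           ≡⟨ cong (_+ᶻ 1ℤ) (up-step x∈A) ⟨
      F (suc x) +ᶻ 1ℤ             ≡⟨ up-step x+1∈A ⟨
      F (suc (suc x))             ∎)
      where open ≡-Reasoning

  room-left : ∀ y θ → + suc y ≤ᶻ F (suc y) +ᶻ (θ +ᶻ θ) → + y ≤ᶻ F y +ᶻ (θ +ᶻ θ)
  room-left y θ room = ≤-by (room ⊕ step-≤ y) (arith (+ y) (F y) (F (suc y)) θ)
    where
    arith : ∀ Y u v θ → Y +ᶻ ((v +ᶻ (θ +ᶻ θ)) +ᶻ (u +ᶻ 1ℤ))
                        ≡ (u +ᶻ (θ +ᶻ θ)) +ᶻ ((1ℤ +ᶻ Y) +ᶻ v)
    arith = solve-∀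

  -- Walk left from y while the walk is ≥ θ + 2 (the room
  -- condition survives); at the first position y' with F y' ≤ θ + 1 the step from y'
  -- is an up-step, and the step before it is either an up-step too, giving the
  -- springboard at y' − 1, or a down-step, and we continue from y' − 1 with θ − 1.
  descent : ∀ y θ → + y ≤ᶻ F y +ᶻ (θ +ᶻ θ) → θ +ᶻ + 2 ≤ᶻ F y → Descent y θ

  descent-from-below : ∀ y θ → + suc y ≤ᶻ F (suc y) +ᶻ (θ +ᶻ θ) → θ +ᶻ + 2 ≤ᶻ F (suc y) →
                       F y <ᶻ θ +ᶻ + 2 → Descent (suc y) θ

  descent zero θ room high = ⊥-elim (pos≰0 {3} (≤-by (room ⊕ high ⊕ high) (arith θ)))
    where
    arith : ∀ θ → + 4 +ᶻ (((0ℤ +ᶻ (θ +ᶻ θ)) +ᶻ 0ℤ) +ᶻ 0ℤ)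
                  ≡ 0ℤ +ᶻ ((0ℤ +ᶻ (θ +ᶻ + 2)) +ᶻ (θ +ᶻ + 2))
    arith = solve-∀
  descent (suc y) θ room high with θ +ᶻ + 2 ℤP.≤? F y
  ... | yes high′ = grow (descent y θ (room-left y θ room) high′) high
  ... | no  low′  = descent-from-below y θ room high (ℤP.≰⇒> low′)

  descent-from-below zero θ room high _ =
    ⊥-elim (pos≰0 {1} (≤-by (room ⊕ high ⊕ high ⊕ step-≤ 0 ⊕ step-≤ 0 ⊕ step-≤ 0)
                            (arith θ (F 1))))
    where
    arith : ∀ θ v → + 2 +ᶻ ((((((v +ᶻ (θ +ᶻ θ)) +ᶻ v) +ᶻ v) +ᶻ (0ℤ +ᶻ 1ℤ)) +ᶻ (0ℤ +ᶻ 1ℤ))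
                             +ᶻ (0ℤ +ᶻ 1ℤ))
                    ≡ 0ℤ +ᶻ (((((1ℤ +ᶻ (θ +ᶻ + 2)) +ᶻ (θ +ᶻ + 2)) +ᶻ v) +ᶻ v) +ᶻ v)
    arith = solve-∀
  descent-from-below (suc y) θ room high below with step-at y
  ... | up y∈A F≡ = weaken (two-ups y∈A (rising-step (ℤP.<-≤-trans below high))) low
    where
    low : F y ≤ᶻ θ
    low = ≤-by (ℤP.i<j⇒suc[i]≤j below ⊕ ℤP.≤-reflexive (sym F≡)) (arith (F y) (F (suc y)) θ)
      where
      arith : ∀ u v θ → u +ᶻ ((θ +ᶻ + 2) +ᶻ v) ≡ θ +ᶻ ((1ℤ +ᶻ v) +ᶻ (u +ᶻ 1ℤ))
      arith = solve-∀
  ... | down _ F≡ = weaken (grow (grow (descent y (θ +ᶻ -1ℤ) room′ high′) high-at-y+1) high-at-y+2)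
                           (ℤP.i-j≤i θ 1ℤ)
    where
    u = F y
    v = F (suc y)
    w = F (suc (suc y))
    w≤v+1 : w ≤ᶻ v +ᶻ 1ℤ
    w≤v+1 = step-≤ (suc y)
    room′ : + y ≤ᶻ u +ᶻ ((θ +ᶻ -1ℤ) +ᶻ (θ +ᶻ -1ℤ))
    room′ = ≤-by (room ⊕ ℤP.≤-reflexive F≡ ⊕ w≤v+1) (arith (+ y) u v w θ)
      where
      arith : ∀ Y u v w θ → Y +ᶻ (((w +ᶻ (θ +ᶻ θ)) +ᶻ (u +ᶻ -1ℤ)) +ᶻ (v +ᶻ 1ℤ))
                            ≡ (u +ᶻ ((θ +ᶻ -1ℤ) +ᶻ (θ +ᶻ -1ℤ))) +ᶻ (((1ℤ +ᶻ (1ℤ +ᶻ Y)) +ᶻ v) +ᶻ w)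
      arith = solve-∀
    high′ : (θ +ᶻ -1ℤ) +ᶻ + 2 ≤ᶻ u
    high′ = ≤-by (high ⊕ w≤v+1 ⊕ ℤP.≤-reflexive F≡ ⊕ slack 1) (arith u v w θ)
      where
      arith : ∀ u v w θ → ((θ +ᶻ -1ℤ) +ᶻ + 2) +ᶻ (((w +ᶻ (v +ᶻ 1ℤ)) +ᶻ (u +ᶻ -1ℤ)) +ᶻ + 1)
                          ≡ u +ᶻ ((((θ +ᶻ + 2) +ᶻ w) +ᶻ v) +ᶻ 0ℤ)
      arith = solve-∀
    high-at-y+1 : (θ +ᶻ -1ℤ) +ᶻ + 2 ≤ᶻ v
    high-at-y+1 = ≤-by (high ⊕ w≤v+1) (arith v w θ)
      where
      arith : ∀ v w θ → ((θ +ᶻ -1ℤ) +ᶻ + 2) +ᶻ (w +ᶻ (v +ᶻ 1ℤ)) ≡ v +ᶻ ((θ +ᶻ + 2) +ᶻ w)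
      arith = solve-∀
    high-at-y+2 : (θ +ᶻ -1ℤ) +ᶻ + 2 ≤ᶻ w
    high-at-y+2 = ≤-by (high ⊕ slack 1) (arith w θ)
      where
      arith : ∀ w θ → ((θ +ᶻ -1ℤ) +ᶻ + 2) +ᶻ (w +ᶻ + 1) ≡ w +ᶻ ((θ +ᶻ + 2) +ᶻ 0ℤ)
      arith = solve-∀

  stretch : ∀ {ρ s θ} → Descent ρ θ → ρ ≤ s → (∀ {e} → e ≤ s → ρ ≤ e → θ +ᶻ + 2 ≤ᶻ F e) →
            Springboard s
  stretch {ρ} (descended (springboard x x+2≤ρ x∈A x+1∈A above) low) ρ≤s high =
    springboard x (ℕP.≤-trans x+2≤ρ ρ≤s) x∈A x+1∈A above′
    where
    above′ : ∀ {e} → e ≤ _ → suc (suc x) ≤ e → F x +ᶻ + 2 ≤ᶻ F e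
    above′ {e} e≤s x+2≤e =
      [ (λ e≤ρ → above e≤ρ x+2≤e) , (λ ρ≤e → two-below low (high e≤s ρ≤e)) ]′ (ℕP.≤-total e ρ)

  record Pivot (s : ℕ) : Set where
    constructor pivot-at
    field
      board : Springboard s
      below : ∀ {e} → e ≤ Springboard.x board → F e +ᶻ + 2 ≤ᶻ F s

  -- Let ρ be the first time the walk reaches F s − 1 and j a minimum of
  -- F on [ρ, s].  The descent from ρ with θ = F j − 2 gives a springboard; the walk
  -- stays ≥ F j ≥ F x + 2 after ρ, and before x < ρ it is ≤ F s − 2.  The room
  -- condition ρ ≤ F ρ + 2θ follows from 3 F s ≥ s + 6, as the walk has to go from
  -- height F ρ ≥ F s − 1 down to F j and back up to F s in s − ρ steps.
  pivot : ∀ s → + s +ᶻ + 6 ≤ᶻ F s +ᶻ (F s +ᶻ F s) → Pivot s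
  pivot s tall = pivot-at (stretch (descent ρ θ room high) ρ≤n valley) below′
    where
    reach : LeastWitness (λ e → F s +ᶻ -1ℤ ≤ᶻ F e) s
    reach = least-witness (λ e → F s +ᶻ -1ℤ ℤP.≤? F e) (≤-by (slack 1) (arith (F s)))
      where
      arith : ∀ v → (v +ᶻ -1ℤ) +ᶻ + 1 ≡ v +ᶻ 0ℤ
      arith = solve-∀
    open LeastWitness reach
    open Minimum (minimum-on F s ρ≤n)
    θ : ℤ
    θ = F j +ᶻ -ᶻ + 2
    room : + ρ ≤ᶻ F ρ +ᶻ (θ +ᶻ θ)
    room = ≤-by (F+n-mono lo≤j ⊕ F-n-anti j≤hi ⊕ tall ⊕ holds ⊕ holds)
                (arith (+ ρ) (+ j) (+ s) (F ρ) (F j) (F s))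
      where
      arith : ∀ R J S fρ fj fs →
              R +ᶻ (((((fj +ᶻ J) +ᶻ (fj +ᶻ S)) +ᶻ (fs +ᶻ (fs +ᶻ fs))) +ᶻ fρ) +ᶻ fρ)
              ≡ (fρ +ᶻ ((fj +ᶻ -ᶻ + 2) +ᶻ (fj +ᶻ -ᶻ + 2)))
                +ᶻ (((((fρ +ᶻ R) +ᶻ (fs +ᶻ J)) +ᶻ (S +ᶻ + 6)) +ᶻ (fs +ᶻ -1ℤ)) +ᶻ (fs +ᶻ -1ℤ))
      arith = solve-∀
    valley : ∀ {e} → e ≤ s → ρ ≤ e → θ +ᶻ + 2 ≤ᶻ F e
    valley {e} e≤s ρ≤e = ≤-by (minimal e≤s ρ≤e) (arith (F j) (F e))
      where
      arith : ∀ fj fe → ((fj +ᶻ -ᶻ + 2) +ᶻ + 2) +ᶻ fe ≡ fe +ᶻ fj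
      arith = solve-∀
    high : θ +ᶻ + 2 ≤ᶻ F ρ
    high = valley ρ≤n ℕP.≤-refl
    open Springboard (Descent.board (descent ρ θ room high)) using (x) renaming (x+2≤y to x+2≤ρ)
    below′ : ∀ {e} → e ≤ x → F e +ᶻ + 2 ≤ᶻ F s
    below′ {e} e≤x = ≤-by (ℤP.i<j⇒suc[i]≤j (ℤP.≰⇒> (first e<ρ))) (arith (F e) (F s))
      where
      e<ρ : e < ρ
      e<ρ = ℕP.≤-trans (s≤s e≤x) (ℕP.≤-trans (ℕP.n≤1+n (suc x)) x+2≤ρ)
      arith : ∀ fe fs → (fe +ᶻ + 2) +ᶻ (fs +ᶻ -1ℤ) ≡ fs +ᶻ (1ℤ +ᶻ fe)
      arith = solve-∀

-- Membership in a subset as a Boolean function of positions (false out of range).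
at : ∀ {n} → Vec Bool n → ℕ → Bool
at []      _       = false
at (b ∷ v) zero    = b
at (b ∷ v) (suc i) = at v i

at-∈ : ∀ {n} (v : Vec Bool n) {e : Fin n} → e ∈ v → at v (toℕ e) ≡ true
at-∈ (_ ∷ _) here      = refl
at-∈ (_ ∷ v) (there p) = at-∈ v p

at-true : ∀ {n} (v : Vec Bool n) {i} → at v i ≡ true → Σ (Fin n) λ e → toℕ e ≡ i × e ∈ v
at-true []           {i}     ()
at-true (true  ∷ v)  {zero}  refl = zero , refl , here
at-true (false ∷ v)  {zero}  ()
at-true (b ∷ v)      {suc i} p with at-true v p
... | e , e≡i , e∈v = suc e , cong suc e≡i , there e∈v

walk-cons : ∀ b {m} (v : Vec Bool m) n →
            Walk.F (at (b ∷ v)) (suc n) ≡ move b +ᶻ Walk.F (at v) n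
walk-cons b v zero    = trans (ℤP.+-identityˡ (move b)) (sym (ℤP.+-identityʳ (move b)))
walk-cons b v (suc n) = trans (cong (_+ᶻ move (at v n)) (walk-cons b v n))
                              (ℤP.+-assoc (move b) _ _)

walk-end : ∀ {n} (v : Vec Bool n) → Walk.F (at v) n +ᶻ + n ≡ + ∣ v ∣ +ᶻ + ∣ v ∣
walk-end []                = refl
walk-end {suc m} (true ∷ v) = begin
    Walk.F (at (true ∷ v)) (suc m) +ᶻ + suc m     ≡⟨ cong (_+ᶻ + suc m) (walk-cons true v m) ⟩
    (1ℤ +ᶻ Walk.F (at v) m) +ᶻ (1ℤ +ᶻ + m)         ≡⟨ arith (Walk.F (at v) m) (+ m) ⟩
    (Walk.F (at v) m +ᶻ + m) +ᶻ + 2                ≡⟨ cong (_+ᶻ + 2) (walk-end v) ⟩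
    (+ ∣ v ∣ +ᶻ + ∣ v ∣) +ᶻ + 2                     ≡⟨ arith′ (+ ∣ v ∣) ⟩
    (1ℤ +ᶻ + ∣ v ∣) +ᶻ (1ℤ +ᶻ + ∣ v ∣)              ∎
  where
  open ≡-Reasoning
  arith : ∀ f M → (1ℤ +ᶻ f) +ᶻ (1ℤ +ᶻ M) ≡ (f +ᶻ M) +ᶻ + 2
  arith = solve-∀
  arith′ : ∀ C → (C +ᶻ C) +ᶻ + 2 ≡ (1ℤ +ᶻ C) +ᶻ (1ℤ +ᶻ C)
  arith′ = solve-∀
walk-end {suc m} (false ∷ v) = begin
    Walk.F (at (false ∷ v)) (suc m) +ᶻ + suc m    ≡⟨ cong (_+ᶻ + suc m) (walk-cons false v m) ⟩
    (-1ℤ +ᶻ Walk.F (at v) m) +ᶻ (1ℤ +ᶻ + m)        ≡⟨ arith (Walk.F (at v) m) (+ m) ⟩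
    Walk.F (at v) m +ᶻ + m                         ≡⟨ walk-end v ⟩
    + ∣ v ∣ +ᶻ + ∣ v ∣                              ∎
  where
  open ≡-Reasoning
  arith : ∀ f M → (-1ℤ +ᶻ f) +ᶻ (1ℤ +ᶻ M) ≡ f +ᶻ M
  arith = solve-∀

walk-height : ∀ {s} (A : Subset s) → 2 * s + 3 ≤ 3 * ∣ A ∣ →
              + s +ᶻ + 6 ≤ᶻ Walk.F (at A) s +ᶻ (Walk.F (at A) s +ᶻ Walk.F (at A) s)
walk-height {s} A dense =
  ≤-by (dense′ ⊕ dense′ ⊕ end ⊕ end ⊕ end) (arith (+ s) (+ ∣ A ∣) (Walk.F (at A) s))
  where
  dense′ : + 2 *ᶻ + s +ᶻ + 3 ≤ᶻ + 3 *ᶻ + ∣ A ∣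
  dense′ = subst₂ _≤ᶻ_ (trans (ℤP.pos-+ (2 * s) 3) (cong (_+ᶻ + 3) (ℤP.pos-* 2 s)))
                       (ℤP.pos-* 3 ∣ A ∣) (+≤+ dense)
  end : + ∣ A ∣ +ᶻ + ∣ A ∣ ≤ᶻ Walk.F (at A) s +ᶻ + s
  end = ℤP.≤-reflexive (sym (walk-end A))
  arith : ∀ S C f →
          (S +ᶻ + 6) +ᶻ (((((+ 3 *ᶻ C) +ᶻ (+ 3 *ᶻ C)) +ᶻ (f +ᶻ S)) +ᶻ (f +ᶻ S)) +ᶻ (f +ᶻ S))
          ≡ (f +ᶻ (f +ᶻ f))
            +ᶻ (((((+ 2 *ᶻ S +ᶻ + 3) +ᶻ (+ 2 *ᶻ S +ᶻ + 3)) +ᶻ (C +ᶻ C)) +ᶻ (C +ᶻ C)) +ᶻ (C +ᶻ C))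
  arith = solve-∀

at-bound : ∀ {n} (v : Vec Bool n) {i} → at v i ≡ true → i < n
at-bound v p with at-true v p
... | e , refl , _ = FinP.toℕ<n e

pair⊆ : ∀ {s} {A : Subset s} {ai aj : Fin s} → ai ∈ A → aj ∈ A →
        ∀ {e} → e ∈ ⁅ ai ⁆ ∪ ⁅ aj ⁆ → e ∈ A
pair⊆ {ai = ai} {aj} ai∈A aj∈A e∈G with x∈p∪q⁻ ⁅ ai ⁆ ⁅ aj ⁆ e∈G
... | inj₁ e∈ai = subst (_∈ _) (sym (x∈⁅y⁆⇒x≡y ai e∈ai)) ai∈A
... | inj₂ e∈aj = subst (_∈ _) (sym (x∈⁅y⁆⇒x≡y aj e∈aj)) aj∈A

module Good {s : ℕ} (A G : Subset s) (G⊆A : ∀ {e} → e ∈ G → e ∈ A) where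

  level⊆A : ∀ {i e} → Level A G i e → e ∈ A
  level⊆A (base e∈G)               = G⊆A e∈G
  level⊆A (step _ _ _ _ _ _ e∈A _) = e∈A

  -- Levels are cumulative, G^(i) ⊆ G^(n) for i ≤ n, as e = e + e − e.
  lift : ∀ {i e} n → i ≤ n → Level A G i e → Level A G n e
  lift zero z≤n ℓ = ℓ
  lift {e = e} (suc n) i≤sn ℓ with ≤-suc-cases i≤sn
  ... | inj₁ i≤n  = step e e e ℓ′ ℓ′ ℓ′ (level⊆A ℓ) refl
    where ℓ′ = lift n i≤n ℓ
  ... | inj₂ refl = ℓ

  closed : ∀ {e x y z} → InGood A G x → InGood A G y → InGood A G z → e ∈ A →
           toℕ e + toℕ x ≡ toℕ y + toℕ z → InGood A G e
  closed (i , ℓx) (j , ℓy) (k , ℓz) e∈A sum =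
    suc (i + (j + k)) , step _ _ _ (lift _ i≤ ℓx) (lift _ j≤ ℓy) (lift _ k≤ ℓz) e∈A sum
    where
    i≤ = ℕP.m≤m+n i (j + k)
    j≤ = ℕP.≤-trans (ℕP.m≤m+n j k) (ℕP.m≤n+m (j + k) i)
    k≤ = ℕP.≤-trans (ℕP.m≤n+m k j) (ℕP.m≤n+m (j + k) i)

  GoodAt : ℕ → Set
  GoodAt n = Σ (Fin s) λ e → toℕ e ≡ n × InGood A G e

  AllGood : ℕ → ℕ → Set
  AllGood lo hi = ∀ {n} → lo ≤ n → n < hi → at A n ≡ true → GoodAt n

  closed-at : ∀ {e x y z} → GoodAt x → GoodAt y → GoodAt z → at A e ≡ true →
              e + x ≡ y + z → GoodAt e
  closed-at (fx , refl , gx) (fy , refl , gy) (fz , refl , gz) e∈A sum with at-true A e∈A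
  ... | fe , refl , fe∈A = fe , refl , closed gx gy gz fe∈A sum

  open Walk (at A)

  -- If all of A ∩ [lo, hi) is good and the walk rises strictly across
  -- [lo, hi), then e ∈ A is good whenever e + u + 1 = lo + hi for a good u: the
  -- pairing lemma gives good c, c' with e + u = c + c'.
  fill : ∀ {lo hi u e} → lo ≤ hi → AllGood lo hi → F lo <ᶻ F hi → GoodAt u →
         at A e ≡ true → suc (e + u) ≡ lo + hi → GoodAt e
  fill {lo} {hi} lo≤hi good rise good-u e∈A sum
    with pairing (hi ∸ lo) (ℕP.m∸n+n≡m lo≤hi) rise
  ... | sym-pair c c' lo≤c c<hi lo≤c' c'<hi c∈A c'∈A sum′ =
    closed-at good-u (good lo≤c c<hi c∈A) (good lo≤c' c'<hi c'∈A) e∈A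
      (ℕP.suc-injective (trans sum (sym sum′)))

  module Sweep (p : Pivot s) where
    open Pivot p
    open Springboard board

    module _ (good-x : GoodAt x) (good-x+1 : GoodAt (suc x)) where

      -- Rightward: every e ∈ A with e ≥ x is good, by filling with u = x and the
      -- window [x+1, e), across which the walk rises as F e ≥ F x + 2 = F (x+1) + 1.
      rightward : ∀ hi → AllGood x hi
      rightward zero _ ()
      rightward (suc hi) {n} x≤n n<shi n∈A with ℕP.m<1+n⇒m<n∨m≡n n<shi
      ... | inj₁ n<hi = rightward hi x≤n n<hi n∈A
      ... | inj₂ refl with ℕP.m≤n⇒m<n∨m≡n x≤n
      ...   | inj₂ refl = good-x
      ...   | inj₁ x<n with ℕP.m≤n⇒m<n∨m≡n x<n
      ...     | inj₂ refl = good-x+1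
      ...     | inj₁ x+1<n =
        fill (ℕP.<⇒≤ x+1<n) (λ x<m → rightward n (ℕP.<⇒≤ x<m)) rise good-x n∈A
             (cong suc (ℕP.+-comm n x))
        where
        rise : F (suc x) <ᶻ F n
        rise = ℤP.suc[i]≤j⇒i<j
          (≤-by (above (ℕP.<⇒≤ (at-bound A n∈A)) x+1<n ⊕ ℤP.≤-reflexive (up-step x∈A))
                (arith (F x) (F (suc x)) (F n)))
          where
          arith : ∀ u v w → (1ℤ +ᶻ v) +ᶻ (w +ᶻ (u +ᶻ 1ℤ)) ≡ w +ᶻ ((u +ᶻ + 2) +ᶻ v)
          arith = solve-∀

      -- Leftward: then every e ∈ A with e < x is good, downwards, by filling with
      -- u the last up-step of the walk after x and the window [e+1, u): there
      -- F u ≥ F s − 1 ≥ F (e+1) + 1.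
      leftward : ∀ d {lo} → d + lo ≡ x → AllGood lo s
      leftward zero refl = rightward s
      leftward (suc d) {lo} d+lo≡x {n} lo≤n n<s n∈A with ℕP.m≤n⇒m<n∨m≡n lo≤n
      ... | inj₁ lo<n = leftward d (trans (ℕP.+-suc d lo) d+lo≡x) lo<n n<s n∈A
      ... | inj₂ refl =
        fill (ℕP.≤-trans lo<x x≤u) (λ lo<m m<u → good-from-lo+1 lo<m (ℕP.<-trans m<u u<s))
             rise (rightward s x≤u u<s u∈A) n∈A refl
        where
        x≤s : x ≤ s
        x≤s = ℕP.≤-trans (ℕP.≤-trans (ℕP.n≤1+n x) (ℕP.n≤1+n (suc x))) x+2≤y
        x<s : F x <ᶻ F s
        x<s = ℤP.suc[i]≤j⇒i<j (≤-by (below ℕP.≤-refl ⊕ slack 1) (arith (F x) (F s)))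
          where
          arith : ∀ fx fs → (1ℤ +ᶻ fx) +ᶻ (fs +ᶻ + 1) ≡ fs +ᶻ ((fx +ᶻ + 2) +ᶻ 0ℤ)
          arith = solve-∀
        open LastUpStep (last-up-step (s ∸ x) (ℕP.m∸n+n≡m x≤s) x<s)
          renaming (lo≤u to x≤u; u<hi to u<s)
        lo<x : lo < x
        lo<x = subst (suc lo ≤_) d+lo≡x (s≤s (ℕP.m≤n+m lo d))
        good-from-lo+1 : AllGood (suc lo) s
        good-from-lo+1 = leftward d (trans (ℕP.+-suc d lo) d+lo≡x)
        rise : F (suc lo) <ᶻ F u
        rise = ℤP.suc[i]≤j⇒i<j
          (≤-by (below lo<x ⊕ reaches ⊕ ℤP.≤-reflexive (up-step u∈A))
                (arith (F (suc lo)) (F s) (F u) (F (suc u))))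
          where
          arith : ∀ f fs fu fsu → (1ℤ +ᶻ f) +ᶻ ((fs +ᶻ fsu) +ᶻ (fu +ᶻ 1ℤ))
                                  ≡ fu +ᶻ (((f +ᶻ + 2) +ᶻ fs) +ᶻ fsu)
          arith = solve-∀

      all-good : AllGood 0 s
      all-good = leftward x (ℕP.+-identityʳ x)

module _ {s : ℕ} (A : Subset s) (p : Walk.Pivot (at A) s) where
  open Walk (at A)
  open Pivot p
  open Springboard board

  springboard-generates : ∃₂ λ (ai aj : Fin s) → ai ∈ A × aj ∈ A × toℕ aj ≡ suc (toℕ ai) ×
                            GoodEq A (⁅ ai ⁆ ∪ ⁅ aj ⁆)
  springboard-generates with at-true A x∈A | at-true A x+1∈A
  ... | ai , ai≡x , ai∈A | aj , aj≡x+1 , aj∈A =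
    ai , aj , ai∈A , aj∈A , trans aj≡x+1 (cong suc (sym ai≡x)) , good≡A
    where
    open Good A (⁅ ai ⁆ ∪ ⁅ aj ⁆) (pair⊆ ai∈A aj∈A)
    open Sweep p
    good-x : GoodAt x
    good-x = ai , ai≡x , zero , base (x∈p∪q⁺ (inj₁ (x∈⁅x⁆ ai)))
    good-x+1 : GoodAt (suc x)
    good-x+1 = aj , aj≡x+1 , zero , base (x∈p∪q⁺ (inj₂ (x∈⁅x⁆ aj)))
    good≡A : GoodEq A (⁅ ai ⁆ ∪ ⁅ aj ⁆)
    good≡A e =
      (λ (_ , ℓ) → level⊆A ℓ) ,
      (λ e∈A → good (all-good good-x good-x+1 z≤n (FinP.toℕ<n e) (at-∈ A e∈A)))
      where
      good : GoodAt (toℕ e) → InGood A (⁅ ai ⁆ ∪ ⁅ aj ⁆) e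
      good (e′ , e′≡e , g) = subst (InGood A _) (FinP.toℕ-injective e′≡e) g

proposition3 : (s : ℕ) → 3 < s → (A : Subset s) →
    2 * s + 3 ≤ 3 * ∣ A ∣ →
    ∃₂ λ (ai aj : Fin s) → ai ∈ A × aj ∈ A × toℕ aj ≡ suc (toℕ ai) ×
    GoodEq A (⁅ ai ⁆ ∪ ⁅ aj ⁆)
proposition3 s _ A dense = springboard-generates A (Walk.pivot (at A) s (walk-height A dense))
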